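{- There exist collections $\mathcal C_1$ and $\mathcal C_2$ of languages over the universe $\mathbb Z$ such that $\mathcal C_1$ is non-uniformly generatable without samples (equivalently, generatable in the limit without samples), $\mathcal C_2$ is uniformly generatable without samples, but $\mathcal C_1 \cup \mathcal C_2$ is not generatable in the limit.
   Context: A language is an infinite subset of a countably infinite universe $U$ (here $U=\mathbb Z$); a collection is a (possibly uncountable) set of languages. An enumeration of a language $K$ is an infinite sequence $x_0, x_1, \dots$ of pairwise distinct elements of $K$ such that every element of $K$ appears in it; $S_t=\{x_0,\dots,x_t\}$. A generator algorithm is an arbitrary function $G$ from finite sequences of elements of $U$ to $U$; its output at time $t$ is $z_t=G(x_0,\dots,x_t)$. $G$ generates in the limit for $\mathcal C$ if for every $K\in\mathcal C$ and every enumeration $x$ of $K$ there is $t^\star$ such that $z_t\in K\setminus S_t$ for all $t\ge t^\star$; $\mathcal C$ is generatable in the limit if such a $G$ exists. A generator without samples is an injection $G:\mathbb N\to U$ (output $z_t=G(t)$). It uniformly generates without samples for $\mathcal C$ if there is $t^\star$ such that $z_t\in K$ for every $K\in\mathcal C$ and every $t\ge t^\star$; it generates in the limit without samples (equivalently, non-uniformly generates without samples) for $\mathcal C$ if for every $K\in\mathcal C$ there is $t^\star$ with $z_t\in K$ for all $t\ge t^\star$. -}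

module Defs where

open import Level using (Level; 0ℓ) renaming (suc to lsuc)
open import Data.Nat using (ℕ; suc; _≥_)
open import Data.Integer using (ℤ)
open import Data.List using (List; map; upTo)
open import Data.List.Membership.Propositional using (_∈_; _∉_)
open import Data.Product using (Σ; ∃; _×_)
open import Data.Sum using (_⊎_)
open import Function.Definitions using (Injective)
open import Relation.Binary.PropositionalEquality using (_≡_)

Subset : Set₁
Subset = ℤ → Set

Infinite : Subset → Set
Infinite K = (l : List ℤ) → ∃ λ y → K y × y ∉ l

-- A (possibly uncountable) collection: a predicate on subsets all of whose
-- members are infinite (i.e. are languages).
Collection : Set₂
Collection = Subset → Set₁

IsCollectionOfLanguages : Collection → Set₁
IsCollectionOfLanguages C = ∀ K → C K → Infinite K

_∪ᶜ_ : Collection → Collection → Collection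
(C₁ ∪ᶜ C₂) K = C₁ K ⊎ C₂ K

record Enumeration (K : Subset) (x : ℕ → ℤ) : Set where
  field
    distinct : Injective _≡_ _≡_ x
    inK      : ∀ i → K (x i)
    covers   : ∀ y → K y → ∃ λ i → x i ≡ y

prefix : (ℕ → ℤ) → ℕ → List ℤ
prefix x t = map x (upTo (suc t))

Generator : Set
Generator = List ℤ → ℤ

GeneratesInTheLimit : Generator → Collection → Set₁
GeneratesInTheLimit G C =
  ∀ K → C K → ∀ x → Enumeration K x →
    ∃ λ t⋆ → ∀ t → t ≥ t⋆ → K (G (prefix x t)) × G (prefix x t) ∉ prefix x t

GeneratableInTheLimit : Collection → Set₁
GeneratableInTheLimit C = ∃ λ (G : Generator) → GeneratesInTheLimit G C

UniformlyGeneratableWithoutSamples : Collection → Set₁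
UniformlyGeneratableWithoutSamples C =
  ∃ λ (G : ℕ → ℤ) → Injective _≡_ _≡_ G ×
    ∃ λ t⋆ → ∀ K → C K → ∀ t → t ≥ t⋆ → K (G t)

NonUniformlyGeneratableWithoutSamples : Collection → Set₁
NonUniformlyGeneratableWithoutSamples C =
  ∃ λ (G : ℕ → ℤ) → Injective _≡_ _≡_ G ×
    (∀ K → C K → ∃ λ t⋆ → ∀ t → t ≥ t⋆ → K (G t))

-- Take C₁ = languages containing all sufficiently negative integers and
-- C₂ = languages containing all naturals; t ↦ -[1+ t ] and t ↦ + t generate
-- them without samples.  Against a generator G for C₁ ∪ C₂ an adversary builds
-- one enumeration in stages.  A stage enumerates a finite prefix and then all
-- remaining negatives in order, so its language lies in C₁ and G eventually
-- outputs a fresh element, necessarily a negative -[1+ m ] of the tail.  The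
-- next stage keeps the prefix up to that time, jumps over m, emits one new
-- natural and continues with negatives.  In the limit every natural is
-- enumerated, so the language lies in C₂, yet at every stage time G outputs an
-- integer that is never enumerated.
module Submission where

open import Defs
open import Level using (Lift; lift)
open import Data.Nat
  using (ℕ; zero; suc; _+_; _∸_; _⊔_; _≤_; _<_; _≤′_; ≤′-reflexive; ≤′-step
        ; z≤n; s≤s; _≤?_; _<?_)
open import Data.Nat.Properties
open import Data.Integer using (ℤ; +_; -[1+_]; ∣_∣)
open import Data.Integer.Properties using (+-injective; -[1+-injective)
open import Data.List using (map)
open import Data.List.Extrema.Nat using (max; xs≤max)
open import Data.List.Membership.Propositional using (_∈_; _∉_)
open import Data.List.Membership.Propositional.Properties
  using (∈-map⁺; ∈-upTo⁺; ∈-upTo⁻)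
open import Data.List.Properties using (map-cong-local)
import Data.List.Relation.Unary.All as All
open import Data.Product using (∃; _×_; _,_; proj₁; proj₂)
open import Data.Sum using (inj₁; inj₂)
open import Data.Empty using (⊥; ⊥-elim)
open import Function using (_∘_)
open import Function.Definitions using (Injective)
open import Relation.Binary.Definitions using (tri<; tri≈; tri>)
open import Relation.Binary.PropositionalEquality
  using (_≡_; _≢_; refl; sym; trans; cong; subst; subst₂)
open import Relation.Nullary using (¬_; yes; no)

Range : (ℕ → ℤ) → Subset
Range x z = ∃ λ i → x i ≡ z

injective⇒enumerates-range : ∀ {x} → Injective _≡_ _≡_ x → Enumeration (Range x) x
injective⇒enumerates-range x-inj = record
  { distinct = x-inj ; inK = λ i → i , refl ; covers = λ _ z∈x → z∈x }

unbounded⇒infinite : ∀ {K : Subset} → (∀ n → ∃ λ y → K y × n ≤ ∣ y ∣) → Infinite K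
unbounded⇒infinite unbounded l =
  let y , y∈K , bound<∣y∣ = unbounded (suc (max 0 (map ∣_∣ l)))
  in y , y∈K , λ y∈l →
       <⇒≱ bound<∣y∣ (All.lookup (xs≤max 0 (map ∣_∣ l)) (∈-map⁺ ∣_∣ y∈l))

∈-prefix : ∀ (x : ℕ → ℤ) {i t} → i ≤ t → x i ∈ prefix x t
∈-prefix x i≤t = ∈-map⁺ x (∈-upTo⁺ (s≤s i≤t))

prefix-cong : ∀ {x y : ℕ → ℤ} t → (∀ i → i ≤ t → x i ≡ y i) → prefix x t ≡ prefix y t
prefix-cong t x≗y = map-cong-local (All.tabulate (λ i∈ → x≗y _ (≤-pred (∈-upTo⁻ i∈))))

stepwise-monotone : (f : ℕ → ℕ) → (∀ i → f i ≤ f (suc i)) → ∀ {i j} → i ≤ j → f i ≤ f j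
stepwise-monotone f f-step = go ∘ ≤⇒≤′
  where
  go : ∀ {i j} → i ≤′ j → f i ≤ f j
  go (≤′-reflexive refl) = ≤-refl
  go (≤′-step p) = ≤-trans (go p) (f-step _)

splice : {A : Set} → (ℕ → A) → ℕ → (ℕ → A) → ℕ → A
splice f n g i with i <? n
... | yes _ = f i
... | no  _ = g (i ∸ n)

splice-< : ∀ {A : Set} (f g : ℕ → A) {n i} → i < n → splice f n g i ≡ f i
splice-< f g {n} {i} i<n with i <? n
... | yes _   = refl
... | no  i≮n = ⊥-elim (i≮n i<n)

splice-≥ : ∀ {A : Set} (f g : ℕ → A) {n i} → n ≤ i → splice f n g i ≡ g (i ∸ n)
splice-≥ f g {n} {i} n≤i with i <? n
... | yes i<n = ⊥-elim (<⇒≱ i<n n≤i)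
... | no  _   = refl

module StabilisingSequence {A : Set} (f : ℕ → ℕ → A) (N : ℕ → ℕ)
  (N-increasing : ∀ n → N n < N (suc n))
  (stable : ∀ n {i} → i < N n → f (suc n) i ≡ f n i) where

  limit : ℕ → A
  limit i = f (suc i) i

  n≤N : ∀ n → n ≤ N n
  n≤N zero    = z≤n
  n≤N (suc n) = ≤-trans (s≤s (n≤N n)) (N-increasing n)

  stable-from : ∀ {m n i} → m ≤ n → i < N m → f n i ≡ f m i
  stable-from {m} {i = i} m≤n i<N = go (≤⇒≤′ m≤n)
    where
    go : ∀ {n} → m ≤′ n → f n i ≡ f m i
    go (≤′-reflexive refl) = refl
    go (≤′-step {n} m≤′n) = trans (stable n (<-≤-trans i<N N[m]≤N[n])) (go m≤′n)
      where
      N[m]≤N[n] : N m ≤ N n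
      N[m]≤N[n] = stepwise-monotone N (<⇒≤ ∘ N-increasing) (≤′⇒≤ m≤′n)

  limit-agrees : ∀ n {i} → i < N n → limit i ≡ f n i
  limit-agrees n {i} i<N with ≤-total (suc i) n
  ... | inj₁ 1+i≤n = sym (stable-from 1+i≤n (n≤N (suc i)))
  ... | inj₂ n≤1+i = stable-from n≤1+i i<N

-- (neg v) emits -[1+ w ] for the least w ≥ v above every negative emitted so far.
data Move : Set where
  pos : Move
  neg : ℕ → Move

record Counters : Set where
  constructor ⟨_,_⟩
  field
    nextNat nextNeg : ℕ
open Counters

emit : Move → Counters → ℤ
emit pos     ⟨ k , p ⟩ = + k
emit (neg v) ⟨ k , p ⟩ = -[1+ p ⊔ v ]

step : Move → Counters → Counters
step pos     ⟨ k , p ⟩ = ⟨ suc k , p ⟩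
step (neg v) ⟨ k , p ⟩ = ⟨ k , suc (p ⊔ v) ⟩

counters : (ℕ → Move) → ℕ → Counters
counters I zero    = ⟨ 0 , 0 ⟩
counters I (suc i) = step (I i) (counters I i)

run : (ℕ → Move) → ℕ → ℤ
run I i = emit (I i) (counters I i)

nextNat-monotone : ∀ I {i j} → i ≤ j → nextNat (counters I i) ≤ nextNat (counters I j)
nextNat-monotone I = stepwise-monotone (nextNat ∘ counters I) (λ i → nextNat-step (I i))
  where
  nextNat-step : ∀ a {c} → nextNat c ≤ nextNat (step a c)
  nextNat-step pos     = n≤1+n _
  nextNat-step (neg _) = ≤-refl

nextNeg-monotone : ∀ I {i j} → i ≤ j → nextNeg (counters I i) ≤ nextNeg (counters I j)
nextNeg-monotone I = stepwise-monotone (nextNeg ∘ counters I) (λ i → nextNeg-step (I i))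
  where
  nextNeg-step : ∀ a {c} → nextNeg c ≤ nextNeg (step a c)
  nextNeg-step pos         = ≤-refl
  nextNeg-step (neg v) {c} = m≤n⇒m≤1+n (m≤m⊔n (nextNeg c) v)

emit≡+ : ∀ a c {u} → emit a c ≡ + u → nextNat c ≡ u × nextNat (step a c) ≡ suc u
emit≡+ pos     _ refl = refl , refl
emit≡+ (neg _) _ ()

emit≡-[1+] : ∀ a c {v} → emit a c ≡ -[1+ v ] → nextNeg c ≤ v × nextNeg (step a c) ≡ suc v
emit≡-[1+] pos     _ ()
emit≡-[1+] (neg w) c refl = m≤m⊔n (nextNeg c) w , refl

run-distinct : ∀ I {i j} → i < j → run I i ≢ run I j
run-distinct I {i} {j} i<j eq with run I i in emitted
... | + u =
  let _ , after-i = emit≡+ (I i) (counters I i) emitted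
      at-j , _    = emit≡+ (I j) (counters I j) (sym eq)
  in 1+n≰n (subst₂ _≤_ after-i at-j (nextNat-monotone I i<j))
... | -[1+ v ] =
  let _ , after-i = emit≡-[1+] (I i) (counters I i) emitted
      at-j , _    = emit≡-[1+] (I j) (counters I j) (sym eq)
  in 1+n≰n (≤-trans (subst (_≤ _) after-i (nextNeg-monotone I i<j)) at-j)

run-injective : ∀ I → Injective _≡_ _≡_ (run I)
run-injective I {i} {j} eq with <-cmp i j
... | tri< i<j _ _ = ⊥-elim (run-distinct I i<j eq)
... | tri≈ _ i≡j _ = i≡j
... | tri> _ _ j<i = ⊥-elim (run-distinct I j<i (sym eq))

run-enumerates : ∀ I → Enumeration (Range (run I)) (run I)
run-enumerates I = injective⇒enumerates-range (run-injective I)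

counters-agree : ∀ {I J M} → (∀ i → i < M → I i ≡ J i) → ∀ {i} → i ≤ M →
                 counters I i ≡ counters J i
counters-agree I≗J {zero}  _   = refl
counters-agree I≗J {suc i} i<M =
  step-cong (I≗J i i<M) (counters-agree I≗J (<⇒≤ i<M))
  where
  step-cong : ∀ {a b c d} → a ≡ b → c ≡ d → step a c ≡ step b d
  step-cong refl refl = refl

run-agree : ∀ {I J M} → (∀ i → i < M → I i ≡ J i) → ∀ {i} → i < M → run I i ≡ run J i
run-agree {I} {J} I≗J {i} i<M
  rewrite I≗J i i<M | counters-agree {I} {J} I≗J (<⇒≤ i<M) = refl

below-nextNat-emitted : ∀ I i {u} → u < nextNat (counters I i) → Range (run I) (+ u)
below-nextNat-emitted I (suc i) u< with I i in move
... | neg _ = below-nextNat-emitted I i u<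
... | pos with m≤n⇒m<n∨m≡n (≤-pred u<)
...   | inj₁ u<k = below-nextNat-emitted I i u<k
...   | inj₂ refl = i , cong (λ a → emit a (counters I i)) move

run-neg0 : ∀ I {i} → I i ≡ neg 0 → run I i ≡ -[1+ nextNeg (counters I i) ]
run-neg0 I {i} move =
  trans (cong (λ a → emit a (counters I i)) move) (cong -[1+_] (⊔-identityʳ _))

-- The skipped index m lies strictly between the negatives emitted before j
-- and those emitted from j on.
skipped-never-emitted : ∀ I {j m v} → nextNeg (counters I j) ≤ m → m < v → I j ≡ neg v →
                        ∀ i → run I i ≢ -[1+ m ]
skipped-never-emitted I {j} {m} {v} before≤m m<v move i emitted
  with emit≡-[1+] (I i) (counters I i) emitted | <-cmp i j
... | _ , after-i | tri< i<j _ _ =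
  1+n≰n (≤-trans (subst (_≤ _) after-i (nextNeg-monotone I i<j)) before≤m)
... | _ | tri≈ _ refl _ =
  <⇒≱ m<v (≤-trans (m≤n⊔m _ v)
    (≤-reflexive (-[1+-injective (trans (sym (cong (λ a → emit a (counters I j)) move)) emitted))))
... | at-i , _ | tri> _ _ j<i = <⇒≱ m<v (begin
  v                                 ≤⟨ m≤n⊔m _ v ⟩
  nextNeg (counters I j) ⊔ v        ≤⟨ n≤1+n _ ⟩
  suc (nextNeg (counters I j) ⊔ v)  ≡⟨ cong (λ a → nextNeg (step a (counters I j))) move ⟨
  nextNeg (counters I (suc j))      ≤⟨ nextNeg-monotone I j<i ⟩
  nextNeg (counters I i)            ≤⟨ at-i ⟩
  m                                 ∎)
  where open ≤-Reasoning

module _ {I : ℕ → Move} {N : ℕ} (tail : ∀ i → N ≤ i → I i ≡ neg 0) where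

  nextNeg-along-tail : ∀ j → nextNeg (counters I (j + N)) ≡ j + nextNeg (counters I N)
  nextNeg-along-tail zero = refl
  nextNeg-along-tail (suc j) rewrite tail (j + N) (m≤n+m N j) =
    cong suc (trans (⊔-identityʳ _) (nextNeg-along-tail j))

  tail-emits-negatives : ∀ {n} → nextNeg (counters I N) ≤ n → Range (run I) -[1+ n ]
  tail-emits-negatives {n} p≤n = n ∸ p + N ,
    trans (run-neg0 I (tail _ (m≤n+m N _)))
          (cong -[1+_] (trans (nextNeg-along-tail (n ∸ p)) (m∸n+n≡m p≤n)))
    where p = nextNeg (counters I N)

  fresh-tail-element : ∀ {t z} → N ≤ t → Range (run I) z → z ∉ prefix (run I) t →
                       ∃ λ m → z ≡ -[1+ m ] × nextNeg (counters I (suc t)) ≤ m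
  fresh-tail-element {t} N≤t (i , refl) fresh with i ≤? t
  ... | yes i≤t = ⊥-elim (fresh (∈-prefix (run I) i≤t))
  ... | no  i≰t = nextNeg (counters I i) ,
                  run-neg0 I (tail i (≤-trans N≤t (<⇒≤ (≰⇒> i≰t)))) ,
                  nextNeg-monotone I (≰⇒> i≰t)

ContainsNegativeTail : Collection
ContainsNegativeTail K = Lift _ (∃ λ B → ∀ n → B ≤ n → K -[1+ n ])

ContainsNaturals : Collection
ContainsNaturals K = Lift _ (∀ n → K (+ n))

negative-tail-infinite : IsCollectionOfLanguages ContainsNegativeTail
negative-tail-infinite K (lift (B , tail)) =
  unbounded⇒infinite (λ n → -[1+ B + n ] , tail _ (m≤m+n B n) , m≤n+m n (suc B))

naturals-infinite : IsCollectionOfLanguages ContainsNaturals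
naturals-infinite K (lift nats) = unbounded⇒infinite (λ n → + n , nats n , ≤-refl)

negative-tail-generatable : NonUniformlyGeneratableWithoutSamples ContainsNegativeTail
negative-tail-generatable =
  -[1+_] , -[1+-injective , λ K (lift (B , tail)) → B , tail

naturals-generatable : UniformlyGeneratableWithoutSamples ContainsNaturals
naturals-generatable = +_ , +-injective , 0 , λ K (lift nats) t _ → nats t

detour : ℕ → ℕ → Move
detour m 0             = neg (suc m)
detour m 1             = pos
detour m (suc (suc _)) = neg 0

module Adversary (G : Generator)
  (generates : GeneratesInTheLimit G (ContainsNegativeTail ∪ᶜ ContainsNaturals)) where

  record Stage : Set where
    field
      committed : ℕ
      moves     : ℕ → Move
      tail      : ∀ i → committed ≤ i → moves i ≡ neg 0
  open Stage

  -- Opaque: unfolding the generator's time t⋆ makes unification blow up.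
  opaque
    stage-generated : ∀ s → ∃ λ t⋆ → ∀ t → t⋆ ≤ t →
      Range (run (moves s)) (G (prefix (run (moves s)) t)) ×
      G (prefix (run (moves s)) t) ∉ prefix (run (moves s)) t
    stage-generated s = generates _ (inj₁ (lift (_ , λ _ → tail-emits-negatives (tail s))))
                                    (run (moves s)) (run-enumerates (moves s))

    time : Stage → ℕ
    time s = proj₁ (stage-generated s) ⊔ committed s

    committed≤time : ∀ s → committed s ≤ time s
    committed≤time s = m≤n⊔m _ _

    skip : ∀ s → ∃ λ m → G (prefix (run (moves s)) (time s)) ≡ -[1+ m ] ×
                         nextNeg (counters (moves s) (suc (time s))) ≤ m
    skip s = let in-range , fresh = proj₂ (stage-generated s) (time s) (m≤m⊔n _ _)
             in fresh-tail-element (tail s) (committed≤time s) in-range fresh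

  next : Stage → Stage
  next s = record
    { committed = 2 + suc (time s)
    ; moves     = splice (moves s) (suc (time s)) (detour (proj₁ (skip s)))
    ; tail      = λ i 3+t≤i →
        trans (splice-≥ (moves s) _ (≤-trans (n≤1+n _) (≤-trans (n≤1+n _) 3+t≤i)))
              (detour-tail (subst (_≤ i ∸ suc (time s)) (m+n∸n≡m 2 (suc (time s)))
                                  (∸-monoˡ-≤ (suc (time s)) 3+t≤i)))
    }
    where
    detour-tail : ∀ {m j} → 2 ≤ j → detour m j ≡ neg 0
    detour-tail (s≤s (s≤s _)) = refl

  stage : ℕ → Stage
  stage zero    = record { committed = 0 ; moves = λ _ → neg 0 ; tail = λ _ _ → refl }
  stage (suc n) = next (stage n)

  committed<time : ∀ n → committed (stage n) < suc (time (stage n))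
  committed<time n = s≤s (committed≤time (stage n))

  open StabilisingSequence (moves ∘ stage) (committed ∘ stage)
    (λ n → m≤n⇒m≤1+n (m≤n⇒m≤1+n (committed<time n)))
    (λ n i<c → splice-< (moves (stage n)) _ (<-trans i<c (committed<time n)))

  ω : ℕ → Move
  ω = limit

  module _ (n : ℕ) where
    private
      s = stage n
      t = time s
      m = proj₁ (skip s)

    ω-before : ∀ i → i < suc t → ω i ≡ moves s i
    ω-before i i<1+t = trans (limit-agrees (suc n) (m≤n⇒m≤1+n (m≤n⇒m≤1+n i<1+t)))
                             (splice-< (moves s) _ i<1+t)

    ω-detour : ∀ j → j < 2 → ω (j + suc t) ≡ detour m j
    ω-detour j j<2 = trans (limit-agrees (suc n) (+-monoˡ-< (suc t) j<2))
      (trans (splice-≥ (moves s) _ (m≤n+m (suc t) j)) (cong (detour m) (m+n∸n≡m j (suc t))))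

    output-skipped : G (prefix (run ω) t) ≡ -[1+ m ]
    output-skipped =
      trans (cong G (prefix-cong t λ i i≤t → run-agree ω-before (s≤s i≤t))) (proj₁ (proj₂ (skip s)))

    nextNeg-before-skip : nextNeg (counters ω (suc t)) ≤ m
    nextNeg-before-skip =
      subst (_≤ m) (cong nextNeg (sym (counters-agree ω-before ≤-refl))) (proj₂ (proj₂ (skip s)))

    ω-output-not-emitted : ¬ Range (run ω) (G (prefix (run ω) t))
    ω-output-not-emitted (i , emitted) =
      skipped-never-emitted ω {j = suc t} nextNeg-before-skip (n<1+n m) (ω-detour 0 (s≤s z≤n)) i
        (trans emitted output-skipped)

    nextNat-grows : suc (nextNat (counters ω (committed s)))
                    ≤ nextNat (counters ω (committed (stage (suc n))))
    nextNat-grows = begin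
      suc (nextNat (counters ω (committed s)))
        ≤⟨ s≤s (nextNat-monotone ω (≤-trans (committed≤time s) (m≤n+m t 2))) ⟩
      suc (nextNat (counters ω (suc (suc t))))
        ≡⟨ cong (λ a → nextNat (step a (counters ω (suc (suc t))))) (ω-detour 1 (s≤s (s≤s z≤n))) ⟨
      nextNat (counters ω (suc (suc (suc t))))
        ∎
      where open ≤-Reasoning

  naturals-emitted : ∀ n → n ≤ nextNat (counters ω (committed (stage n)))
  naturals-emitted zero    = z≤n
  naturals-emitted (suc n) = ≤-trans (s≤s (naturals-emitted n)) (nextNat-grows n)

  ω-language : ContainsNaturals (Range (run ω))
  ω-language = lift λ n →
    below-nextNat-emitted ω (committed (stage (suc n))) (naturals-emitted (suc n))

  absurd : ⊥
  absurd =
    let T , eventually = generates _ (inj₂ ω-language) (run ω) (run-enumerates ω)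
    in ω-output-not-emitted T
         (proj₁ (eventually (time (stage T)) (≤-trans (n≤N T) (committed≤time (stage T)))))

theorem1p1 : ∃ λ (C₁ : Collection) → ∃ λ (C₂ : Collection) →
    IsCollectionOfLanguages C₁ × IsCollectionOfLanguages C₂ ×
    NonUniformlyGeneratableWithoutSamples C₁ ×
    UniformlyGeneratableWithoutSamples C₂ ×
    ¬ GeneratableInTheLimit (C₁ ∪ᶜ C₂)
theorem1p1 =
  ContainsNegativeTail , ContainsNaturals ,
  negative-tail-infinite , naturals-infinite ,
  negative-tail-generatable , naturals-generatable ,
  λ (G , generates) → Adversary.absurd G generates
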